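{- Let $p$ be a prime, $\tau_0:=\lfloor (p-3)/3\rfloor$, and let $A=\{a_1,\dots,a_q\}\subseteq\mathbb{Z}_p\setminus\{0\}$ be a set of $q$ distinct elements with the property that whenever $\alpha_1b_1+\alpha_2b_2+\alpha_3b_3\equiv0\pmod p$ for some $b_1,b_2,b_3\in A$ and integers $\alpha_1,\alpha_2,\alpha_3$ with $|\alpha_i|\le4$, then $\alpha_1+\alpha_2+\alpha_3=0$ and $b_i=b_j$ for all $i,j\in[3]$ with $\alpha_i,\alpha_j\ne0$. On the vertex set $W=\{w_i: i\in\mathbb{Z}_p\setminus\{0\}\}$, for $a\in\mathbb{Z}_p\setminus\{0\}$ and $i\in[\tau_0]$ let $H^a_i$ be the complete graph on $\{w_{a(3i-2)},w_{a(3i-1)},w_{a(3i)},w_{a(3i+1)},w_{a(3i+2)}\}$ (indices mod $p$), and for $j\in[q]$ let $G^j:=\bigcup_{i\in[\tau_0]}H^{a_j}_i$. Then for every copy $F$ of $K_5^-$ in $\bigcup_{j\in[q]}G^j$ there is $j\in[q]$ with $F\subseteq G^j$.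
   Context: $K_5^-$ denotes $K_5$ with one edge removed. -}

module Defs where

open import Data.Nat using (ℕ; zero; suc; _+_; _*_; _∸_; _≤_; _<_; NonZero)
open import Data.Nat.DivMod using (_/_; _%_)
open import Data.Nat.Primality using (Prime)
open import Data.Integer as ℤ using (ℤ; +_; ∣_∣)
open import Data.Integer.Divisibility using () renaming (_∣_ to _∣ℤ_)
open import Data.Fin using (Fin; zero; suc)
open import Data.Product using (Σ; ∃; _×_; _,_)
open import Relation.Binary.PropositionalEquality using (_≡_; _≢_)
open import Relation.Nullary using (¬_)
open import Data.Sum using (_⊎_)

-- Elements of ℤ_p are represented by naturals in {0,…,p-1};
-- the vertex w_x (x ∈ ℤ_p ∖ {0}) is represented by the natural x.

-- τ₀ = ⌊(p-3)/3⌋  (for p = 2 the true value is -1; here it is 0,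
-- but in both cases [τ₀] is empty, so nothing changes).
τ₀ : ℕ → ℕ
τ₀ p = (p ∸ 3) / 3

-- {x , y} is an edge of H^a_i, i.e. x, y are two distinct vertices among
-- w_{a(3i-2)}, …, w_{a(3i+2)}  (indices mod p).  We write 3i+s with
-- s ∈ {-2,…,2} as 3i-2+k with k ∈ {0,…,4}.
EdgeH : (p : ℕ) .{{_ : NonZero p}} → ℕ → ℕ → ℕ → ℕ → Set
EdgeH p a i x y =
  x ≢ y ×
  (Σ ℕ λ k → Σ ℕ λ l → k < 5 × l < 5 ×
     x ≡ (a * (3 * i ∸ 2 + k)) % p × y ≡ (a * (3 * i ∸ 2 + l)) % p)

EdgeG : (p : ℕ) .{{_ : NonZero p}} → ℕ → ℕ → ℕ → Set
EdgeG p a x y = Σ ℕ λ i → 1 ≤ i × i ≤ τ₀ p × EdgeH p a i x y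

MissingPair : Fin 5 → Fin 5 → Set
MissingPair u v = (u ≡ zero × v ≡ suc zero) ⊎ (u ≡ suc zero × v ≡ zero)

IsK5minus : (ℕ → ℕ → Set) → (Fin 5 → ℕ) → Set
IsK5minus E f =
  (∀ u v → f u ≡ f v → u ≡ v) ×
  (∀ u v → u ≢ v → ¬ MissingPair u v → E (f u) (f v))

SmallComb : ℤ → Set
SmallComb α = ∣ α ∣ ≤ 4

AProperty : (p q : ℕ) → (Fin q → ℕ) → Set
AProperty p q a =
  ∀ (j₁ j₂ j₃ : Fin q) (α₁ α₂ α₃ : ℤ) →
  SmallComb α₁ → SmallComb α₂ → SmallComb α₃ →
  (+ p) ∣ℤ (α₁ ℤ.* + a j₁ ℤ.+ α₂ ℤ.* + a j₂ ℤ.+ α₃ ℤ.* + a j₃) →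
  (α₁ ℤ.+ α₂ ℤ.+ α₃ ≡ + 0) ×
  (α₁ ≢ + 0 → α₂ ≢ + 0 → a j₁ ≡ a j₂) ×
  (α₁ ≢ + 0 → α₃ ≢ + 0 → a j₁ ≡ a j₃) ×
  (α₂ ≢ + 0 → α₃ ≢ + 0 → a j₂ ≡ a j₃)

-- An edge {x, y} of G^a joins two of the five vertices a(3i-2), …, a(3i+2), so
-- x ≡ y + d·a (mod p) with 0 < |d| ≤ 4.  Around a triangle whose edges lie in
-- G^{a_{j₁}}, G^{a_{j₂}}, G^{a_{j₃}} these congruences add up to
-- d₁a_{j₁} + d₂a_{j₂} + d₃a_{j₃} ≡ 0, and the hypothesis on A forces
-- a_{j₁} = a_{j₂} = a_{j₃}: every triangle is monochromatic.  Any two edges of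
-- K₅⁻ are linked by a chain of triangles, so the whole copy lies in one G^j.

module Submission where

open import Defs
open import Data.Nat using (ℕ; _<_; NonZero)
open import Data.Nat.Primality using (Prime)
open import Data.Fin using (Fin)
open import Data.Empty using (⊥)
open import Data.Product using (Σ; _×_)
open import Relation.Binary.PropositionalEquality using (_≡_; _≢_)

import Data.Nat as ℕ
open import Data.Nat using (_≤_; s≤s⁻¹)
import Data.Nat.Properties as ℕ
open import Data.Nat.DivMod using (_/_; _%_; m%n≤m; m%n≡m∸m/n*n; m/n*n≤m)
open import Data.Integer using (ℤ; +_; 0ℤ; _⊖_; _+_; _-_; _*_; -_; ∣_∣)
open import Data.Integer.Properties using (+-injective; i-j≡0⇒i≡j; [+m]-[+n]≡m⊖n; m-n≡m⊖n; ⊖-≥; ∣m⊝n∣≤m⊔n; pos-+; pos-*)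
open import Data.Integer.Divisibility.Signed using (_∣_; divides; ∣⇒∣ᵤ; ∣m∣n⇒∣m+n; ∣m∣n⇒∣m-n; ∣m⇒∣-m)
open import Data.Integer.Tactic.RingSolver using (solve-∀)
open import Data.Fin using (zero; suc)
open import Data.Product using (_,_; proj₁; proj₂)
open import Data.Sum using (inj₁; inj₂)
open import Data.Empty using (⊥-elim)
open import Relation.Binary.PropositionalEquality using (refl; sym; trans; cong; cong₂; subst; module ≡-Reasoning)
open import Relation.Nullary using (¬_)

pattern F0 = zero
pattern F1 = suc zero
pattern F2 = suc (suc zero)
pattern F3 = suc (suc (suc zero))
pattern F4 = suc (suc (suc (suc zero)))

∣k-l∣≤n : ∀ {n k l} → k ≤ n → l ≤ n → ∣ + k - + l ∣ ≤ n
∣k-l∣≤n {n} {k} {l} k≤n l≤n =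
  subst (_≤ n) (cong ∣_∣ (sym ([+m]-[+n]≡m⊖n k l))) (ℕ.≤-trans (∣m⊝n∣≤m⊔n k l) (ℕ.⊔-lub k≤n l≤n))

k-l≢0 : ∀ {k l} → k ≢ l → + k - + l ≢ 0ℤ
k-l≢0 {k} {l} k≢l k-l≡0 = k≢l (+-injective (i-j≡0⇒i≡j (+ k) (+ l) k-l≡0))

p∣m-m%p : ∀ m p .{{_ : NonZero p}} → + p ∣ + m - + (m % p)
p∣m-m%p m p = divides (+ (m / p)) (begin
  + m - + (m % p)           ≡⟨ m-n≡m⊖n m (m % p) ⟩
  m ⊖ m % p                 ≡⟨ ⊖-≥ (m%n≤m m p) ⟩
  + (m ℕ.∸ m % p)           ≡⟨ cong (λ r → + (m ℕ.∸ r)) (m%n≡m∸m/n*n m p) ⟩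
  + (m ℕ.∸ (m ℕ.∸ m / p ℕ.* p)) ≡⟨ cong +_ (ℕ.m∸[m∸n]≡n (m/n*n≤m m p)) ⟩
  + (m / p ℕ.* p)           ≡⟨ pos-* (m / p) p ⟩
  + (m / p) * + p           ∎)
  where open ≡-Reasoning

p∣[m%p-n%p]-[m-n] : ∀ m n p .{{_ : NonZero p}} → + p ∣ (+ (m % p) - + (n % p)) - (+ m - + n)
p∣[m%p-n%p]-[m-n] m n p =
  subst (+ p ∣_) (regroup (+ m) (+ n) (+ (m % p)) (+ (n % p))) (∣m∣n⇒∣m-n (p∣m-m%p n p) (p∣m-m%p m p))
  where
  regroup : ∀ M N R S → (N - S) - (M - R) ≡ (R - S) - (M - N)
  regroup = solve-∀

a[c+k]-a[c+l] : ∀ a c k l → + (a ℕ.* (c ℕ.+ k)) - + (a ℕ.* (c ℕ.+ l)) ≡ (+ k - + l) * + a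
a[c+k]-a[c+l] a c k l = begin
  + (a ℕ.* (c ℕ.+ k)) - + (a ℕ.* (c ℕ.+ l)) ≡⟨ cong₂ _-_ (cast k) (cast l) ⟩
  + a * (+ c + + k) - + a * (+ c + + l)     ≡⟨ distribute (+ a) (+ c) (+ k) (+ l) ⟩
  (+ k - + l) * + a                         ∎
  where
  open ≡-Reasoning
  cast : ∀ k → + (a ℕ.* (c ℕ.+ k)) ≡ + a * (+ c + + k)
  cast k = trans (pos-* a (c ℕ.+ k)) (cong (+ a *_) (pos-+ c k))
  distribute : ∀ A C K L → A * (C + K) - A * (C + L) ≡ (K - L) * A
  distribute = solve-∀

p∣cyclic-sum : ∀ {p} x y z d₁ d₂ d₃ b₁ b₂ b₃ →
  p ∣ (x - y) - d₁ * b₁ → p ∣ (y - z) - d₂ * b₂ → p ∣ (z - x) - d₃ * b₃ →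
  p ∣ d₁ * b₁ + d₂ * b₂ + d₃ * b₃
p∣cyclic-sum {p} x y z d₁ d₂ d₃ b₁ b₂ b₃ p∣₁ p∣₂ p∣₃ =
  subst (p ∣_) (sym (telescope x y z d₁ d₂ d₃ b₁ b₂ b₃)) (∣m⇒∣-m (∣m∣n⇒∣m+n (∣m∣n⇒∣m+n p∣₁ p∣₂) p∣₃))
  where
  telescope : ∀ X Y Z D₁ D₂ D₃ B₁ B₂ B₃ → D₁ * B₁ + D₂ * B₂ + D₃ * B₃ ≡
    - (((X - Y) - D₁ * B₁) + ((Y - Z) - D₂ * B₂) + ((Z - X) - D₃ * B₃))
  telescope = solve-∀

Offset : ℕ → ℕ → ℕ → ℕ → Set
Offset p a x y = Σ ℤ λ d → d ≢ 0ℤ × ∣ d ∣ ≤ 4 × + p ∣ (+ x - + y) - d * + a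

module _ (p : ℕ) .{{_ : NonZero p}} where

  EdgeG-sym : ∀ {a x y} → EdgeG p a x y → EdgeG p a y x
  EdgeG-sym (i , 1≤i , i≤τ₀ , x≢y , k , l , k<5 , l<5 , x≡ , y≡) =
    i , 1≤i , i≤τ₀ , (λ y≡x → x≢y (sym y≡x)) , l , k , l<5 , k<5 , y≡ , x≡

  EdgeG⇒Offset : ∀ {a x y} → EdgeG p a x y → Offset p a x y
  EdgeG⇒Offset {a} (i , _ , _ , x≢y , k , l , k<5 , l<5 , refl , refl) =
    + k - + l , k-l≢0 k≢l , ∣k-l∣≤n (s≤s⁻¹ k<5) (s≤s⁻¹ l<5) ,
    subst (λ t → + p ∣ (+ (m k % p) - + (m l % p)) - t) (a[c+k]-a[c+l] a c k l)
      (p∣[m%p-n%p]-[m-n] (m k) (m l) p)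
    where
    c : ℕ
    c = 3 ℕ.* i ℕ.∸ 2
    m : ℕ → ℕ
    m k = a ℕ.* (c ℕ.+ k)
    k≢l : k ≢ l
    k≢l refl = x≢y refl

  EdgeG-triangle : ∀ q (a : Fin q → ℕ) → (∀ j k → a j ≡ a k → j ≡ k) → AProperty p q a →
    ∀ {j₁ j₂ j₃ x y z} → EdgeG p (a j₁) x y → EdgeG p (a j₂) y z → EdgeG p (a j₃) z x → j₁ ≡ j₂
  EdgeG-triangle q a a-injective a-property {j₁} {j₂} {j₃} {x} {y} {z} xy yz zx
    with EdgeG⇒Offset xy | EdgeG⇒Offset yz | EdgeG⇒Offset zx
  ... | d₁ , d₁≢0 , ∣d₁∣≤4 , p∣₁ | d₂ , d₂≢0 , ∣d₂∣≤4 , p∣₂ | d₃ , _ , ∣d₃∣≤4 , p∣₃ =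
    a-injective j₁ j₂ (proj₁ (proj₂ (a-property j₁ j₂ j₃ d₁ d₂ d₃ ∣d₁∣≤4 ∣d₂∣≤4 ∣d₃∣≤4 (∣⇒∣ᵤ p∣sum))) d₁≢0 d₂≢0)
    where
    p∣sum : + p ∣ d₁ * + a j₁ + d₂ * + a j₂ + d₃ * + a j₃
    p∣sum = p∣cyclic-sum (+ x) (+ y) (+ z) d₁ d₂ d₃ (+ a j₁) (+ a j₂) (+ a j₃) p∣₁ p∣₂ p∣₃

module _ {V C : Set} (E : C → V → V → Set)
  (E-sym : ∀ {c x y} → E c x y → E c y x)
  (E-triangle : ∀ {c₁ c₂ c₃ x y z} → E c₁ x y → E c₂ y z → E c₃ z x → c₁ ≡ c₂) where

  recolour : ∀ {c₁ c₂ c₃ x y z} → E c₁ x y → E c₂ y z → E c₃ z x → E c₁ y z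
  recolour xy yz zx = subst (λ c → E c _ _) (sym (E-triangle xy yz zx)) yz

  K₅⁻-monochromatic : (f : Fin 5 → V) →
    (∀ u v → u ≢ v → ¬ MissingPair u v → Σ C λ c → E c (f u) (f v)) →
    Σ C λ c → ∀ u v → u ≢ v → ¬ MissingPair u v → E c (f u) (f v)
  K₅⁻-monochromatic f edge = c₀ , monochromatic
    where
    ¬missing : ∀ {u w} → ¬ MissingPair u (suc (suc w))
    ¬missing (inj₁ (_ , ()))
    ¬missing (inj₂ (_ , ()))

    -- Vertices 2, 3, 4 span a triangle; every other edge joins 0 or 1 to it.
    c₀ : C
    c₀ = proj₁ (edge F2 F3 (λ ()) ¬missing)

    g23 : E c₀ (f F2) (f F3)
    g23 = proj₂ (edge F2 F3 (λ ()) ¬missing)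

    g34 : E c₀ (f F3) (f F4)
    g34 = recolour g23 (proj₂ (edge F3 F4 (λ ()) ¬missing)) (E-sym (proj₂ (edge F2 F4 (λ ()) ¬missing)))

    g42 : E c₀ (f F4) (f F2)
    g42 = recolour g34 (E-sym (proj₂ (edge F2 F4 (λ ()) ¬missing))) g23

    Spokes : Fin 5 → Set
    Spokes u = E c₀ (f F2) (f u) × E c₀ (f u) (f F3) × E c₀ (f F4) (f u)

    spokes : ∀ u → u ≢ F2 → u ≢ F3 → u ≢ F4 → Spokes u
    spokes u u≢2 u≢3 u≢4 = g2u , gu3 , recolour g34 (E-sym (proj₂ (edge u F4 u≢4 ¬missing))) u3
      where
      u3 : E (proj₁ (edge u F3 u≢3 ¬missing)) (f u) (f F3)
      u3 = proj₂ (edge u F3 u≢3 ¬missing)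
      g2u : E c₀ (f F2) (f u)
      g2u = recolour (E-sym g23) (E-sym (proj₂ (edge u F2 u≢2 ¬missing))) u3
      gu3 : E c₀ (f u) (f F3)
      gu3 = recolour g2u u3 (E-sym g23)

    spokes₀ : Spokes F0
    spokes₀ = spokes F0 (λ ()) (λ ()) (λ ())

    spokes₁ : Spokes F1
    spokes₁ = spokes F1 (λ ()) (λ ()) (λ ())

    monochromatic : ∀ u v → u ≢ v → ¬ MissingPair u v → E c₀ (f u) (f v)
    monochromatic F0 F1 _ m = ⊥-elim (m (inj₁ (refl , refl)))
    monochromatic F1 F0 _ m = ⊥-elim (m (inj₂ (refl , refl)))
    monochromatic F0 F0 u≢v _ = ⊥-elim (u≢v refl)
    monochromatic F1 F1 u≢v _ = ⊥-elim (u≢v refl)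
    monochromatic F2 F2 u≢v _ = ⊥-elim (u≢v refl)
    monochromatic F3 F3 u≢v _ = ⊥-elim (u≢v refl)
    monochromatic F4 F4 u≢v _ = ⊥-elim (u≢v refl)
    monochromatic F2 F3 _ _ = g23
    monochromatic F3 F2 _ _ = E-sym g23
    monochromatic F3 F4 _ _ = g34
    monochromatic F4 F3 _ _ = E-sym g34
    monochromatic F4 F2 _ _ = g42
    monochromatic F2 F4 _ _ = E-sym g42
    monochromatic F2 F0 _ _ = proj₁ spokes₀
    monochromatic F0 F2 _ _ = E-sym (proj₁ spokes₀)
    monochromatic F0 F3 _ _ = proj₁ (proj₂ spokes₀)
    monochromatic F3 F0 _ _ = E-sym (proj₁ (proj₂ spokes₀))
    monochromatic F4 F0 _ _ = proj₂ (proj₂ spokes₀)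
    monochromatic F0 F4 _ _ = E-sym (proj₂ (proj₂ spokes₀))
    monochromatic F2 F1 _ _ = proj₁ spokes₁
    monochromatic F1 F2 _ _ = E-sym (proj₁ spokes₁)
    monochromatic F1 F3 _ _ = proj₁ (proj₂ spokes₁)
    monochromatic F3 F1 _ _ = E-sym (proj₁ (proj₂ spokes₁))
    monochromatic F4 F1 _ _ = proj₂ (proj₂ spokes₁)
    monochromatic F1 F4 _ _ = E-sym (proj₂ (proj₂ spokes₁))

lemma3p4 : (p : ℕ) .{{_ : NonZero p}} → Prime p → (q : ℕ) → (a : Fin q → ℕ) →
  (∀ j → a j < p) → (∀ j → a j ≢ 0) → (∀ j k → a j ≡ a k → j ≡ k) →
  AProperty p q a →
  (f : Fin 5 → ℕ) →
  IsK5minus (λ x y → Σ (Fin q) λ j → EdgeG p (a j) x y) f →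
  Σ (Fin q) λ j → ∀ u v → u ≢ v → (MissingPair u v → ⊥) → EdgeG p (a j) (f u) (f v)
lemma3p4 p _ q a _ _ a-injective a-property f (_ , edges) =
  K₅⁻-monochromatic (λ j → EdgeG p (a j)) (λ {j} → EdgeG-sym p {a j}) (EdgeG-triangle p q a a-injective a-property) f edges
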